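{- For any number $x$ and any natural numbers $d,s,k$: $$\mathcal F_{s+d,k}(x+d)=\sum_{j=0}^{d}\binom dj\,\mathcal F_{s+j,k}(x),\qquad \mathcal F_{s,k}(x+d)=\mathcal F_{s,k}(x)+\sum_{j=0}^{d-1}\mathcal F_{s-1,k}(x+j).$$
   Context: For integers $s$ and natural $k$, the Moser polynomial is $\mathcal F_{s,k}(x)=\sum_{j=1}^{s}(-1)^{j-1}j^{k-1}\binom{x}{s-j}$, where $\binom{x}{m}=x(x-1)\cdots(x-m+1)/m!$ for $m\ge0$ and $\binom xm=0$ for $m<0$ (so $\mathcal F_{s,k}=0$ for $s\le0$). -}

module Defs where

open import Data.Nat as ℕ using (ℕ; zero; suc; _∸_)
open import Data.Nat.Combinatorics using (_C_)
open import Data.Integer as ℤ using (ℤ; +_; -[1+_])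
open import Data.Rational using (ℚ; _/_; _+_; _-_; _*_; 0ℚ; 1ℚ)

nℚ : ℕ → ℚ
nℚ n = + n / 1

-- generalized binomial coefficient  binom x m = x(x-1)...(x-m+1)/m!  (m ≥ 0)
binom : ℚ → ℕ → ℚ
binom x zero    = 1ℚ
binom x (suc m) = binom x m * (x - nℚ m) * (+ 1 / suc m)

sgn : ℕ → ℚ
sgn zero          = 1ℚ
sgn (suc zero)    = + 0 / 1 - 1ℚ
sgn (suc (suc n)) = sgn n

sumBelow : ℕ → (ℕ → ℚ) → ℚ
sumBelow zero    f = 0ℚ
sumBelow (suc n) f = sumBelow n f + f n

-- Moser polynomial F_{s,k}(x) = Σ_{j=1}^{s} (-1)^{j-1} j^{k-1} binom x (s-j),
-- and F_{s,k} = 0 for s ≤ 0.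
moser : ℤ → ℕ → ℚ → ℚ
moser -[1+ _ ] k x = 0ℚ
moser (+ s)    k x =
  sumBelow s (λ i → sgn i * (nℚ ((suc i) ℕ.^ (k ∸ 1)) * binom x (s ∸ suc i)))

module Submission where

-- Both identities of Proposition 3.9 follow from a single recurrence,
--   F_{s+1,k}(x+1) = F_{s+1,k}(x) + F_{s,k}(x),                    (moser-step)
-- obtained by applying Pascal's rule  binom (x+1) (m+1) = binom x (m+1) + binom x m
-- to every summand of F_{s+1,k}(x+1): the first halves reassemble F_{s+1,k}(x), the
-- second halves are the summands of F_{s,k}(x) shifted by one index.
--
-- Iterating the recurrence in x alone gives the second identity
-- (moser-shift); iterating it in s and x simultaneously, and merging the two sums
-- with Pascal's rule for ordinary binomial coefficients (binomial-sum-pascal), gives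
-- the first (moser-shift-binomial).

open import Defs
open import Data.Nat as ℕ using (ℕ; zero; suc; _∸_; _<_; s≤s)
import Data.Nat.Properties as ℕP
open import Data.Nat.Combinatorics using (_C_; nCk+nC[k+1]≡[n+1]C[k+1]; k>n⇒nCk≡0)
open import Data.Integer as ℤ using (ℤ; +_)
import Data.Integer.Properties as ℤP
open import Data.Rational using (ℚ; _+_; _*_; _-_; _/_; 0ℚ; 1ℚ; toℚᵘ)
import Data.Rational.Properties as ℚP
open import Data.Rational.Solver using (module +-*-Solver)
import Data.Rational.Unnormalised as ℚᵘ
import Data.Rational.Unnormalised.Properties as ℚᵘP
open import Data.Product using (_×_; _,_)
open import Function using (_∘_)
open import Relation.Binary.PropositionalEquality

toℚᵘ-nℚ : ∀ n → toℚᵘ (nℚ n) ℚᵘ.≃ ℚᵘ.mkℚᵘ (+ n) 0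
toℚᵘ-nℚ n = ℚP.toℚᵘ-fromℚᵘ (ℚᵘ.mkℚᵘ (+ n) 0)

ℕ-+-as-ℚᵘ : ∀ a b → ℚᵘ.mkℚᵘ (+ a) 0 ℚᵘ.+ ℚᵘ.mkℚᵘ (+ b) 0 ℚᵘ.≃ ℚᵘ.mkℚᵘ (+ (a ℕ.+ b)) 0
ℕ-+-as-ℚᵘ a b = ℚᵘ.*≡* (begin
    (+ a ℤ.* + 1 ℤ.+ + b ℤ.* + 1) ℤ.* + 1  ≡⟨ ℤP.*-identityʳ _ ⟩
    + a ℤ.* + 1 ℤ.+ + b ℤ.* + 1            ≡⟨ cong₂ ℤ._+_ (ℤP.*-identityʳ (+ a)) (ℤP.*-identityʳ (+ b)) ⟩
    + a ℤ.+ + b                            ≡⟨ ℤP.pos-+ a b ⟨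
    + (a ℕ.+ b)                            ≡⟨ ℤP.*-identityʳ _ ⟨
    + (a ℕ.+ b) ℤ.* (+ 1 ℤ.* + 1)          ∎)
  where open ≡-Reasoning

nℚ-+ : ∀ a b → nℚ a + nℚ b ≡ nℚ (a ℕ.+ b)
nℚ-+ a b = ℚP.toℚᵘ-injective (begin
    toℚᵘ (nℚ a + nℚ b)                    ≈⟨ ℚP.toℚᵘ-homo-+ (nℚ a) (nℚ b) ⟩
    toℚᵘ (nℚ a) ℚᵘ.+ toℚᵘ (nℚ b)           ≈⟨ ℚᵘP.+-cong (toℚᵘ-nℚ a) (toℚᵘ-nℚ b) ⟩
    ℚᵘ.mkℚᵘ (+ a) 0 ℚᵘ.+ ℚᵘ.mkℚᵘ (+ b) 0   ≈⟨ ℕ-+-as-ℚᵘ a b ⟩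
    ℚᵘ.mkℚᵘ (+ (a ℕ.+ b)) 0               ≈⟨ toℚᵘ-nℚ (a ℕ.+ b) ⟨
    toℚᵘ (nℚ (a ℕ.+ b))                   ∎)
  where open ℚᵘP.≃-Reasoning

nℚ-suc : ∀ n → nℚ (suc n) ≡ nℚ n + 1ℚ
nℚ-suc n = trans (cong nℚ (ℕP.+-comm 1 n)) (sym (nℚ-+ n 1))

reciprocal-nℚ : ∀ m → (+ 1 / suc m) * nℚ (suc m) ≡ 1ℚ
reciprocal-nℚ m = ℚP.toℚᵘ-injective (begin
    toℚᵘ ((+ 1 / suc m) * nℚ (suc m))                       ≈⟨ ℚP.toℚᵘ-homo-* (+ 1 / suc m) (nℚ (suc m)) ⟩
    toℚᵘ (+ 1 / suc m) ℚᵘ.* toℚᵘ (nℚ (suc m))                ≈⟨ ℚᵘP.*-cong (ℚP.toℚᵘ-fromℚᵘ (ℚᵘ.mkℚᵘ (+ 1) m)) (toℚᵘ-nℚ (suc m)) ⟩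
    ℚᵘ.1/ ℚᵘ.mkℚᵘ (+ suc m) 0 ℚᵘ.* ℚᵘ.mkℚᵘ (+ suc m) 0        ≈⟨ ℚᵘP.*-inverseˡ (ℚᵘ.mkℚᵘ (+ suc m) 0) ⟩
    ℚᵘ.1ℚᵘ                                                  ∎)
  where open ℚᵘP.≃-Reasoning

binom-suc-* : ∀ x m → binom x (suc m) * nℚ (suc m) ≡ binom x m * (x - nℚ m)
binom-suc-* x m = begin
    binom x m * (x - nℚ m) * (+ 1 / suc m) * nℚ (suc m)    ≡⟨ ℚP.*-assoc (binom x m * (x - nℚ m)) (+ 1 / suc m) (nℚ (suc m)) ⟩
    binom x m * (x - nℚ m) * ((+ 1 / suc m) * nℚ (suc m))  ≡⟨ cong (binom x m * (x - nℚ m) *_) (reciprocal-nℚ m) ⟩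
    binom x m * (x - nℚ m) * 1ℚ                             ≡⟨ ℚP.*-identityʳ _ ⟩
    binom x m * (x - nℚ m)                                  ∎
  where open ≡-Reasoning

binom-pascal : ∀ x m → binom (x + 1ℚ) (suc m) ≡ binom x (suc m) + binom x m
binom-pascal x zero = solve 1 (λ x → con 1ℚ :* ((x :+ con 1ℚ) :- con 0ℚ) :* con 1ℚ
                                    := con 1ℚ :* (x :- con 0ℚ) :* con 1ℚ :+ con 1ℚ) refl x
  where open +-*-Solver
binom-pascal x (suc m) = begin
    binom (x + 1ℚ) (suc m) * ((x + 1ℚ) - nℚ (suc m)) * u      ≡⟨ cong₂ (λ c N → c * ((x + 1ℚ) - N) * u) (binom-pascal x m) (nℚ-suc m) ⟩
    (B + b) * ((x + 1ℚ) - (M + 1ℚ)) * u                       ≡⟨ expand B b x M u ⟩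
    (B * (x - M) + b * (x - M)) * u                           ≡⟨ cong (λ t → (B * (x - M) + t) * u) lower ⟩
    (B * (x - M) + B * (M + 1ℚ)) * u                          ≡⟨ regroup B x M u ⟩
    B * (x - (M + 1ℚ)) * u + B * (u * ((M + 1ℚ) + 1ℚ))        ≡⟨ cong (λ t → B * (x - (M + 1ℚ)) * u + B * t) upper ⟩
    B * (x - (M + 1ℚ)) * u + B * 1ℚ                           ≡⟨ cong₂ (λ N t → B * (x - N) * u + t) (sym (nℚ-suc m)) (ℚP.*-identityʳ B) ⟩
    B * (x - nℚ (suc m)) * u + B                              ∎
  where
  open ≡-Reasoning
  B b M u : ℚ
  B = binom x (suc m)
  b = binom x m
  M = nℚ m
  u = + 1 / suc (suc m)
  lower : b * (x - M) ≡ B * (M + 1ℚ)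
  lower = trans (sym (binom-suc-* x m)) (cong (B *_) (nℚ-suc m))
  upper : u * ((M + 1ℚ) + 1ℚ) ≡ 1ℚ
  upper = trans (cong (u *_) (sym (trans (nℚ-suc (suc m)) (cong (_+ 1ℚ) (nℚ-suc m))))) (reciprocal-nℚ (suc m))
  expand : ∀ B b x M u → (B + b) * ((x + 1ℚ) - (M + 1ℚ)) * u ≡ (B * (x - M) + b * (x - M)) * u
  expand = solve 5 (λ B b x M u → (B :+ b) :* ((x :+ con 1ℚ) :- (M :+ con 1ℚ)) :* u
                                 := (B :* (x :- M) :+ b :* (x :- M)) :* u) refl
    where open +-*-Solver
  regroup : ∀ B x M u → (B * (x - M) + B * (M + 1ℚ)) * u ≡ B * (x - (M + 1ℚ)) * u + B * (u * ((M + 1ℚ) + 1ℚ))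
  regroup = solve 4 (λ B x M u → (B :* (x :- M) :+ B :* (M :+ con 1ℚ)) :* u
                               := B :* (x :- (M :+ con 1ℚ)) :* u :+ B :* (u :* ((M :+ con 1ℚ) :+ con 1ℚ))) refl
    where open +-*-Solver

sumBelow-cong : ∀ n {f g : ℕ → ℚ} → (∀ i → i < n → f i ≡ g i) → sumBelow n f ≡ sumBelow n g
sumBelow-cong zero    f≗g = refl
sumBelow-cong (suc n) f≗g =
  cong₂ _+_ (sumBelow-cong n (λ i i<n → f≗g i (ℕP.m<n⇒m<1+n i<n))) (f≗g n (ℕP.n<1+n n))

sumBelow-+ : ∀ n (f g : ℕ → ℚ) → sumBelow n (λ i → f i + g i) ≡ sumBelow n f + sumBelow n g
sumBelow-+ zero    f g = refl
sumBelow-+ (suc n) f g = trans (cong (_+ (f n + g n)) (sumBelow-+ n f g))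
  (solve 4 (λ a b c d → (a :+ b) :+ (c :+ d) := (a :+ c) :+ (b :+ d)) refl
     (sumBelow n f) (sumBelow n g) (f n) (g n))
  where open +-*-Solver

sumBelow-first : ∀ n (f : ℕ → ℚ) → sumBelow (suc n) f ≡ f 0 + sumBelow n (λ i → f (suc i))
sumBelow-first zero    f = ℚP.+-comm 0ℚ (f 0)
sumBelow-first (suc n) f = trans (cong (_+ f (suc n)) (sumBelow-first n f)) (ℚP.+-assoc (f 0) _ _)

binomPrev : ℚ → ℕ → ℚ
binomPrev x zero    = 0ℚ
binomPrev x (suc m) = binom x m

binom-pascal-all : ∀ x n → binom (x + 1ℚ) n ≡ binom x n + binomPrev x n
binom-pascal-all x zero    = refl
binom-pascal-all x (suc m) = binom-pascal x m

moserTerm : ℕ → ℕ → ℚ → ℚ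
moserTerm k i c = sgn i * (nℚ (suc i ℕ.^ (k ∸ 1)) * c)

moserTerm-+ : ∀ k i a b → moserTerm k i (a + b) ≡ moserTerm k i a + moserTerm k i b
moserTerm-+ k i = solve 4 (λ σ p a b → σ :* (p :* (a :+ b)) := σ :* (p :* a) :+ σ :* (p :* b)) refl
                    (sgn i) (nℚ (suc i ℕ.^ (k ∸ 1)))
  where open +-*-Solver

moserTerm-0 : ∀ k i → moserTerm k i 0ℚ ≡ 0ℚ
moserTerm-0 k i = trans (cong (sgn i *_) (ℚP.*-zeroʳ (nℚ (suc i ℕ.^ (k ∸ 1))))) (ℚP.*-zeroʳ (sgn i))

∸-suc : ∀ s i → i < s → s ∸ i ≡ suc (s ∸ suc i)
∸-suc (suc s) i (s≤s i≤s) = ℕP.+-∸-assoc 1 i≤s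

-- Replacing each binomial factor binom x (s+1-(i+1)) by binom x (s-(i+1)) turns
-- F_{s+1} into F_s: the summands shift down and the last one vanishes.
moser-binomPrev : ∀ s k x → sumBelow (suc s) (λ i → moserTerm k i (binomPrev x (s ∸ i))) ≡ moser (+ s) k x
moser-binomPrev s k x = begin
    sumBelow s (λ i → moserTerm k i (binomPrev x (s ∸ i))) + moserTerm k s (binomPrev x (s ∸ s))
      ≡⟨ cong₂ _+_ (sumBelow-cong s (λ i i<s → cong (moserTerm k i ∘ binomPrev x) (∸-suc s i i<s)))
                   (trans (cong (moserTerm k s ∘ binomPrev x) (ℕP.n∸n≡0 s)) (moserTerm-0 k s)) ⟩
    moser (+ s) k x + 0ℚ
      ≡⟨ ℚP.+-identityʳ _ ⟩
    moser (+ s) k x ∎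
  where open ≡-Reasoning

moser-step : ∀ s k x → moser (+ suc s) k (x + 1ℚ) ≡ moser (+ suc s) k x + moser (+ s) k x
moser-step s k x = begin
    sumBelow (suc s) (λ i → moserTerm k i (binom (x + 1ℚ) (s ∸ i)))
      ≡⟨ sumBelow-cong (suc s) (λ i _ → trans (cong (moserTerm k i) (binom-pascal-all x (s ∸ i)))
                                               (moserTerm-+ k i _ _)) ⟩
    sumBelow (suc s) (λ i → moserTerm k i (binom x (s ∸ i)) + moserTerm k i (binomPrev x (s ∸ i)))
      ≡⟨ sumBelow-+ (suc s) _ _ ⟩
    moser (+ suc s) k x + sumBelow (suc s) (λ i → moserTerm k i (binomPrev x (s ∸ i)))
      ≡⟨ cong (λ t → moser (+ suc s) k x + t) (moser-binomPrev s k x) ⟩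
    moser (+ suc s) k x + moser (+ s) k x ∎
  where open ≡-Reasoning

moser-step-ℤ : ∀ s k x → moser (+ s) k (x + 1ℚ) ≡ moser (+ s) k x + moser (+ s ℤ.- + 1) k x
moser-step-ℤ zero    k x = refl
moser-step-ℤ (suc s) k x = moser-step s k x

x+nℚ-suc : ∀ x d → x + nℚ (suc d) ≡ (x + nℚ d) + 1ℚ
x+nℚ-suc x d = trans (cong (λ t → x + t) (nℚ-suc d)) (sym (ℚP.+-assoc x (nℚ d) 1ℚ))

moser-shift : ∀ x d s k → moser (+ s) k (x + nℚ d)
              ≡ moser (+ s) k x + sumBelow d (λ j → moser (+ s ℤ.- + 1) k (x + nℚ j))
moser-shift x zero s k = trans (cong (moser (+ s) k) (ℚP.+-identityʳ x)) (sym (ℚP.+-identityʳ _))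
moser-shift x (suc d) s k = begin
    moser (+ s) k (x + nℚ (suc d))                    ≡⟨ cong (moser (+ s) k) (x+nℚ-suc x d) ⟩
    moser (+ s) k ((x + nℚ d) + 1ℚ)                    ≡⟨ moser-step-ℤ s k (x + nℚ d) ⟩
    moser (+ s) k (x + nℚ d) + F⁻ d                    ≡⟨ cong (_+ F⁻ d) (moser-shift x d s k) ⟩
    (moser (+ s) k x + sumBelow d F⁻) + F⁻ d           ≡⟨ ℚP.+-assoc (moser (+ s) k x) (sumBelow d F⁻) (F⁻ d) ⟩
    moser (+ s) k x + sumBelow (suc d) F⁻              ∎
  where
  open ≡-Reasoning
  F⁻ : ℕ → ℚ
  F⁻ j = moser (+ s ℤ.- + 1) k (x + nℚ j)

binomial-sum-pascal : ∀ d (g : ℕ → ℚ) →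
  sumBelow (suc (suc d)) (λ j → nℚ (suc d C j) * g j)
  ≡ sumBelow (suc d) (λ j → nℚ (d C j) * g (suc j)) + sumBelow (suc d) (λ j → nℚ (d C j) * g j)
binomial-sum-pascal d g = begin
    sumBelow (suc (suc d)) (λ j → nℚ (suc d C j) * g j)
      ≡⟨ sumBelow-first (suc d) _ ⟩
    g₀ + sumBelow (suc d) (λ j → nℚ (suc d C suc j) * g (suc j))
      ≡⟨ cong (λ t → g₀ + t) (sumBelow-cong (suc d) (λ j _ → split j)) ⟩
    g₀ + sumBelow (suc d) (λ j → nℚ (d C j) * g (suc j) + nℚ (d C suc j) * g (suc j))
      ≡⟨ cong (λ t → g₀ + t) (sumBelow-+ (suc d) _ _) ⟩
    g₀ + (A + (B + nℚ (d C suc d) * g (suc d)))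
      ≡⟨ cong (λ c → g₀ + (A + (B + nℚ c * g (suc d)))) (k>n⇒nCk≡0 (ℕP.n<1+n d)) ⟩
    g₀ + (A + (B + 0ℚ * g (suc d)))
      ≡⟨ cong (λ t → g₀ + (A + (B + t))) (ℚP.*-zeroˡ (g (suc d))) ⟩
    g₀ + (A + (B + 0ℚ))
      ≡⟨ cong (λ t → g₀ + (A + t)) (ℚP.+-identityʳ B) ⟩
    g₀ + (A + B)
      ≡⟨ solve 3 (λ a A B → a :+ (A :+ B) := A :+ (a :+ B)) refl g₀ A B ⟩
    A + (g₀ + B)
      ≡⟨ cong (λ t → A + t) (sumBelow-first d (λ j → nℚ (d C j) * g j)) ⟨
    A + sumBelow (suc d) (λ j → nℚ (d C j) * g j) ∎
  where
  open ≡-Reasoning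
  open +-*-Solver
  g₀ A B : ℚ
  g₀ = nℚ 1 * g 0
  A  = sumBelow (suc d) (λ j → nℚ (d C j) * g (suc j))
  B  = sumBelow d (λ j → nℚ (d C suc j) * g (suc j))
  split : ∀ j → nℚ (suc d C suc j) * g (suc j) ≡ nℚ (d C j) * g (suc j) + nℚ (d C suc j) * g (suc j)
  split j = begin
      nℚ (suc d C suc j) * g (suc j)                     ≡⟨ cong (λ c → nℚ c * g (suc j)) (nCk+nC[k+1]≡[n+1]C[k+1] d j) ⟨
      nℚ (d C j ℕ.+ d C suc j) * g (suc j)               ≡⟨ cong (_* g (suc j)) (nℚ-+ (d C j) (d C suc j)) ⟨
      (nℚ (d C j) + nℚ (d C suc j)) * g (suc j)          ≡⟨ ℚP.*-distribʳ-+ (g (suc j)) (nℚ (d C j)) (nℚ (d C suc j)) ⟩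
      nℚ (d C j) * g (suc j) + nℚ (d C suc j) * g (suc j) ∎

moser-shift-binomial : ∀ d x s k → moser (+ (s ℕ.+ d)) k (x + nℚ d)
                       ≡ sumBelow (suc d) (λ j → nℚ (d C j) * moser (+ (s ℕ.+ j)) k x)
moser-shift-binomial zero x s k = begin
    moser (+ (s ℕ.+ 0)) k (x + nℚ 0)       ≡⟨ cong₂ (λ a y → moser (+ a) k y) (ℕP.+-identityʳ s) (ℚP.+-identityʳ x) ⟩
    moser (+ s) k x                        ≡⟨ ℚP.*-identityˡ _ ⟨
    1ℚ * moser (+ s) k x                   ≡⟨ cong (λ a → 1ℚ * moser (+ a) k x) (ℕP.+-identityʳ s) ⟨
    1ℚ * moser (+ (s ℕ.+ 0)) k x           ≡⟨ ℚP.+-identityˡ _ ⟨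
    0ℚ + 1ℚ * moser (+ (s ℕ.+ 0)) k x      ∎
  where open ≡-Reasoning
moser-shift-binomial (suc d) x s k = begin
    moser (+ (s ℕ.+ suc d)) k (x + nℚ (suc d))
      ≡⟨ cong₂ (λ a y → moser (+ a) k y) (ℕP.+-suc s d) (x+nℚ-suc x d) ⟩
    moser (+ suc (s ℕ.+ d)) k ((x + nℚ d) + 1ℚ)
      ≡⟨ moser-step (s ℕ.+ d) k (x + nℚ d) ⟩
    moser (+ (suc s ℕ.+ d)) k (x + nℚ d) + moser (+ (s ℕ.+ d)) k (x + nℚ d)
      ≡⟨ cong₂ _+_ (moser-shift-binomial d x (suc s) k) (moser-shift-binomial d x s k) ⟩
    sumBelow (suc d) (λ j → nℚ (d C j) * F (suc s ℕ.+ j)) + sumBelow (suc d) (λ j → nℚ (d C j) * F (s ℕ.+ j))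
      ≡⟨ cong (_+ sumBelow (suc d) (λ j → nℚ (d C j) * F (s ℕ.+ j)))
              (sumBelow-cong (suc d) (λ j _ → cong (λ a → nℚ (d C j) * F a) (ℕP.+-suc s j))) ⟨
    sumBelow (suc d) (λ j → nℚ (d C j) * F (s ℕ.+ suc j)) + sumBelow (suc d) (λ j → nℚ (d C j) * F (s ℕ.+ j))
      ≡⟨ binomial-sum-pascal d (λ j → F (s ℕ.+ j)) ⟨
    sumBelow (suc (suc d)) (λ j → nℚ (suc d C j) * F (s ℕ.+ j)) ∎
  where
  open ≡-Reasoning
  F : ℕ → ℚ
  F a = moser (+ a) k x

proposition3p9 : (x : ℚ) (d s k : ℕ) →
    (moser (+ (s ℕ.+ d)) k (x + nℚ d)
       ≡ sumBelow (suc d) (λ j → nℚ (d C j) * moser (+ (s ℕ.+ j)) k x))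
    × (moser (+ s) k (x + nℚ d)
       ≡ moser (+ s) k x + sumBelow d (λ j → moser (+ s ℤ.- + 1) k (x + nℚ j)))
proposition3p9 x d s k = moser-shift-binomial d x s k , moser-shift x d s k
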